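{- Let $n = 2k \geq 4$ be even. Every schedule for an asynchronous single round-robin tournament with $n$ teams has guaranteed rest time at most $k-2$.
   Context: An asynchronous single round-robin tournament with $n$ teams is one in which every pair of distinct teams plays each other exactly once and no two games take place at the same time; a schedule is a linear ordering of the $\binom{n}{2}$ games. The guaranteed rest time of a schedule is the maximum integer $b$ such that any two games involving the same team are separated (in the ordering) by at least $b$ games not involving that team. -}

module Defs where

open import Data.Nat using (ℕ; _≤_)
open import Data.Nat.Combinatorics using (_C_)
open import Data.Fin using (Fin; _<_; _<?_; _≟_)
open import Data.Product using (Σ; _×_; _,_; proj₁; proj₂)
open import Data.Sum using (_⊎_)
open import Data.List using (List; length; filter)
open import Relation.Nullary using (Dec; ¬_; _×-dec_; _⊎-dec_; ¬?)
open import Relation.Binary.PropositionalEquality using (_≡_)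
open import Function.Bundles using (_⤖_; Bijection)
open import Data.List.Base using (allFin)

-- A game between teams of Fin n: an unordered pair {a , b} of distinct
-- teams, represented canonically as (a , b) with a < b.
Game : ℕ → Set
Game n = Σ (Fin n × Fin n) λ p → proj₁ p < proj₂ p

Involves : ∀ {n} → Fin n → Game n → Set
Involves x ((a , b) , _) = (a ≡ x) ⊎ (b ≡ x)

involves? : ∀ {n} (x : Fin n) (g : Game n) → Dec (Involves x g)
involves? x ((a , b) , _) = (a ≟ x) ⊎-dec (b ≟ x)

-- A schedule: a linear ordering of all (n choose 2) games, i.e. a bijection
-- from positions Fin (n C 2) to games.
Schedule : ℕ → Set
Schedule n = Fin (n C 2) ⤖ Game n

restBetween : ∀ {n} → Schedule n → Fin n → Fin (n C 2) → Fin (n C 2) → ℕ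
restBetween {n} s x t t' =
  length (filter (λ u → (t <? u) ×-dec ((u <? t') ×-dec ¬? (involves? x (Bijection.to s u))))
                 (allFin (n C 2)))

RestAtLeast : ∀ {n} → Schedule n → ℕ → Set
RestAtLeast {n} s b =
  ∀ (x : Fin n) (t t' : Fin (n C 2)) → t < t' →
  Involves x (Bijection.to s t) → Involves x (Bijection.to s t') →
  b ≤ restBetween s x t t'

module Submission where

-- Let n = 2k with k ≥ 2 and suppose a schedule
-- s had guaranteed rest time b ≥ k - 1.  Two games at most b positions apart
-- cannot share a team, because fewer than b games lie between them.  Look at
-- the games g₀, …, g_k in positions 0, …, k (there are that many games since
-- k < (2k choose 2)).  The games g₀, …, g_{k-1} are pairwise team-disjoint, so
-- these k games use all 2k teams.  Each team of g_k avoids g₁, …, g_{k-1}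
-- (they are within distance k - 1 ≤ b of g_k), hence it plays in g₀.  A game
-- is determined by its two teams, so g_k = g₀, contradicting injectivity of
-- the schedule.

open import Defs
open import Data.Nat using (ℕ; _≤_; _*_; _∸_)
open import Data.Nat as ℕ using (zero; suc; _+_; _⊔_; z≤n; s≤s; _≤?_)
import Data.Nat.Properties as ℕP
open import Data.Nat.Combinatorics using (_C_; nC1≡n; nCk+nC[k+1]≡[n+1]C[k+1])
open import Data.Fin as F using (Fin; toℕ; fromℕ<; inject≤; punchOut; remQuot; combine)
import Data.Fin.Properties as FP
open import Data.Product using (∃; _×_; _,_; uncurry)
open import Data.Sum using (inj₁; inj₂)
open import Data.Empty using (⊥; ⊥-elim)
open import Data.List using (length; filter; tabulate)
open import Relation.Nullary using (yes; no; ¬_; ¬?; _×-dec_)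
open import Relation.Unary using (Decidable)
open import Relation.Binary using (tri<; tri≈; tri>)
open import Relation.Binary.PropositionalEquality
open import Function.Definitions using (Injective)
open import Function.Bundles using (Bijection)
open import Function.Base using (id; _∘′_)

module _ {a p} {A : Set a} {Q : A → Set p} (Q? : Decidable Q) (w : A → ℕ)
         (lo hi : ℕ) (window : ∀ u → Q u → lo ≤ w u × w u ℕ.< hi) where

  count-window : ∀ {N} m (f : Fin N → A) → (∀ i → w (f i) ≡ m + toℕ i) →
                 length (filter Q? (tabulate f)) ≤ hi ∸ (m ⊔ lo)
  count-window {zero} m f weights = z≤n
  count-window {suc N} m f weights with Q? (f F.zero)
  ... | yes q =
    let lo≤m , m<hi = head-in-window q
    in begin
      suc (length (filter Q? (tabulate (f ∘′ F.suc))))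
        ≤⟨ s≤s tail-bound ⟩
      suc (hi ∸ (suc m ⊔ lo))
        ≡⟨ cong (λ z → suc (hi ∸ z)) (ℕP.m≥n⇒m⊔n≡m (ℕP.m≤n⇒m≤1+n lo≤m)) ⟩
      suc (hi ∸ suc m)
        ≡⟨ ℕP.+-∸-assoc 1 m<hi ⟨
      hi ∸ m
        ≡⟨ cong (hi ∸_) (ℕP.m≥n⇒m⊔n≡m lo≤m) ⟨
      hi ∸ (m ⊔ lo) ∎
    where
    open ℕP.≤-Reasoning
    head-in-window : Q (f F.zero) → lo ≤ m × m ℕ.< hi
    head-in-window q = subst (λ z → lo ≤ z × z ℕ.< hi)
                         (trans (weights F.zero) (ℕP.+-identityʳ m)) (window _ q)
    tail-bound : length (filter Q? (tabulate (f ∘′ F.suc))) ≤ hi ∸ (suc m ⊔ lo)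
    tail-bound = count-window (suc m) (f ∘′ F.suc)
                   (λ i → trans (weights (F.suc i)) (ℕP.+-suc m (toℕ i)))
  ... | no ¬q =
    ℕP.≤-trans (count-window (suc m) (f ∘′ F.suc)
                  (λ i → trans (weights (F.suc i)) (ℕP.+-suc m (toℕ i))))
               (ℕP.∸-monoʳ-≤ hi (ℕP.⊔-monoˡ-≤ lo (ℕP.n≤1+n m)))

restBetween-bound : ∀ {n} (s : Schedule n) x t t' →
                    restBetween s x t t' ≤ toℕ t' ∸ suc (toℕ t)
restBetween-bound s x t t' =
  count-window strictly-between-and-resting toℕ (suc (toℕ t)) (toℕ t')
    (λ u (t<u , u<t' , _) → t<u , u<t') 0 id (λ _ → refl)
  where
  strictly-between-and-resting :
    Decidable (λ u → t F.< u × u F.< t' × ¬ Involves x (Bijection.to s u))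
  strictly-between-and-resting u =
    (t F.<? u) ×-dec ((u F.<? t') ×-dec ¬? (involves? x (Bijection.to s u)))

Disjoint : ∀ {n} → Game n → Game n → Set
Disjoint g h = ∀ x → Involves x g → Involves x h → ⊥

nearby-games-disjoint : ∀ {n} (s : Schedule n) {b} → RestAtLeast s b →
  ∀ t t' → t F.< t' → toℕ t' ≤ toℕ t + b →
  Disjoint (Bijection.to s t) (Bijection.to s t')
nearby-games-disjoint s {b} rest t t' t<t' close x in-t in-t' =
  ℕP.<-irrefl refl (ℕP.<-≤-trans fewer-than-b (rest x t t' t<t' in-t in-t'))
  where
  open ℕP.≤-Reasoning
  fewer-than-b : restBetween s x t t' ℕ.< b
  fewer-than-b = begin-strict
    restBetween s x t t'     ≤⟨ restBetween-bound s x t t' ⟩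
    toℕ t' ∸ suc (toℕ t)     <⟨ ℕP.n<1+n _ ⟩
    suc (toℕ t' ∸ suc (toℕ t)) ≡⟨ ℕP.+-∸-assoc 1 t<t' ⟨
    toℕ t' ∸ toℕ t           ≤⟨ ℕP.m≤n+o⇒m∸n≤o (toℕ t') (toℕ t) close ⟩
    b                        ∎

team : ∀ {n} → Fin 2 → Game n → Fin n
team F.zero             ((a , _) , _) = a
team (F.suc F.zero)     ((_ , b) , _) = b

team-involved : ∀ {n} c (g : Game n) → Involves (team c g) g
team-involved F.zero         g = inj₁ refl
team-involved (F.suc F.zero) g = inj₂ refl

team-injective : ∀ {n} (g : Game n) {c c'} → team c g ≡ team c' g → c ≡ c'
team-injective g                 {F.zero}       {F.zero}       _ = refl
team-injective ((a , b) , a<b)   {F.zero}       {F.suc F.zero} e =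
  ⊥-elim (ℕP.<-irrefl (cong toℕ e) a<b)
team-injective ((a , b) , a<b)   {F.suc F.zero} {F.zero}       e =
  ⊥-elim (ℕP.<-irrefl (cong toℕ (sym e)) a<b)
team-injective g                 {F.suc F.zero} {F.suc F.zero} _ = refl

game-determined : ∀ {n} (g h : Game n) →
  Involves (team F.zero g) h → Involves (team (F.suc F.zero) g) h → g ≡ h
game-determined ((a , b) , a<b) ((_ , _) , _) (inj₁ refl) (inj₁ refl) =
  ⊥-elim (ℕP.<-irrefl refl a<b)
game-determined ((a , b) , a<b) ((_ , _) , a<b') (inj₁ refl) (inj₂ refl) =
  cong ((a , b) ,_) (ℕP.<-irrelevant a<b a<b')
game-determined ((a , b) , a<b) ((_ , _) , b<a) (inj₂ refl) (inj₁ refl) =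
  ⊥-elim (ℕP.<-asym a<b b<a)
game-determined ((a , b) , a<b) ((_ , _) , _) (inj₂ refl) (inj₂ refl) =
  ⊥-elim (ℕP.<-irrefl refl a<b)

injective⇒surjective : ∀ {n} {f : Fin n → Fin n} → Injective _≡_ _≡_ f →
                       ∀ y → ∃ λ x → f x ≡ y
injective⇒surjective {suc n} {f} f-inj y with FP.any? (λ x → f x F.≟ y)
... | yes hit = hit
... | no ¬hit = ⊥-elim (FP.<⇒notInjective (ℕP.n<1+n n) avoid-y-injective)
  where
  y≢f : ∀ x → y ≢ f x
  y≢f x e = ¬hit (x , sym e)
  avoid-y : Fin (suc n) → Fin n
  avoid-y x = punchOut (y≢f x)
  avoid-y-injective : Injective _≡_ _≡_ avoid-y
  avoid-y-injective {x} {x'} e = f-inj (FP.punchOut-injective (y≢f x) (y≢f x') e)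

-- k pairwise disjoint games among 2k teams involve every team: their 2k
-- team slots are filled injectively, hence surjectively.
disjoint-games-cover : ∀ {k} (g : Fin k → Game (2 * k)) →
  (∀ i j → i ≢ j → Disjoint (g i) (g j)) → ∀ x → ∃ λ j → Involves x (g j)
disjoint-games-cover {k} g disjoint x =
  let p , player-p≡x = injective⇒surjective player-injective x
      c , j = remQuot {2} k p
  in j , subst (λ z → Involves z (g j)) player-p≡x (team-involved c (g j))
  where
  slot : Fin 2 × Fin k → Fin (2 * k)
  slot (c , j) = team c (g j)
  slot-injective : Injective _≡_ _≡_ slot
  slot-injective {c , j} {c' , j'} e with j F.≟ j'
  ... | no j≢j' = ⊥-elim (disjoint j j' j≢j' _ (team-involved c (g j))
                    (subst (λ z → Involves z (g j')) (sym e) (team-involved c' (g j'))))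
  ... | yes refl = cong (_, j) (team-injective (g j) e)
  player : Fin (2 * k) → Fin (2 * k)
  player p = slot (remQuot {2} k p)
  player-injective : Injective _≡_ _≡_ player
  player-injective {p} {p'} e = begin
    p                                   ≡⟨ FP.combine-remQuot {2} k p ⟨
    uncurry combine (remQuot {2} k p)   ≡⟨ cong (uncurry combine) same-slot ⟩
    uncurry combine (remQuot {2} k p')  ≡⟨ FP.combine-remQuot {2} k p' ⟩
    p'                                  ∎
    where
    open ≡-Reasoning
    same-slot : remQuot {2} k p ≡ remQuot {2} k p'
    same-slot = slot-injective {remQuot {2} k p} {remQuot {2} k p'} e

n≤[1+n]C2 : ∀ n → n ≤ suc n C 2
n≤[1+n]C2 n = subst (n ≤_) (nCk+nC[k+1]≡[n+1]C[k+1] n 1)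
  (subst (_≤ n C 1 + n C 2) (nC1≡n n) (ℕP.m≤m+n (n C 1) (n C 2)))

positions-0-to-k-exist : ∀ m → 2 + m ℕ.< (2 * (2 + m)) C 2
positions-0-to-k-exist m = ℕP.≤-trans 3+m≤2k-1 (n≤[1+n]C2 _)
  where
  3+m≤2k-1 : 3 + m ≤ suc (m + (2 + (m + 0)))
  3+m≤2k-1 = subst (λ z → 3 + m ≤ suc (m + (2 + z))) (sym (ℕP.+-identityʳ m))
                   (s≤s (ℕP.m≤n+m (2 + m) m))

module NoLongRest {N} (q : ℕ) (game : Fin N → Game (2 * suc q))
                  (game-injective : Injective _≡_ _≡_ game)
                  (q+1<N : suc q ℕ.< N) (b : ℕ) (q≤b : q ≤ b)
                  (nearby : ∀ t t' → t F.< t' → toℕ t' ≤ toℕ t + b →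
                            Disjoint (game t) (game t')) where

  early : Fin (suc q) → Fin N
  early j = inject≤ j (ℕP.<⇒≤ q+1<N)

  last : Fin N
  last = fromℕ< q+1<N

  -- Positions 0, …, q are pairwise within distance q ≤ b.
  ordered-early-disjoint : ∀ i j → toℕ i ℕ.< toℕ j →
                           Disjoint (game (early i)) (game (early j))
  ordered-early-disjoint i j i<j =
    nearby (early i) (early j)
      (subst₂ ℕ._<_ (sym (FP.toℕ-inject≤ i _)) (sym (FP.toℕ-inject≤ j _)) i<j)
      (subst₂ (λ u v → v ≤ u + b) (sym (FP.toℕ-inject≤ i _)) (sym (FP.toℕ-inject≤ j _))
        (ℕP.≤-trans (ℕP.≤-pred (FP.toℕ<n j)) (ℕP.≤-trans q≤b (ℕP.m≤n+m b (toℕ i)))))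

  early-disjoint : ∀ i j → i ≢ j → Disjoint (game (early i)) (game (early j))
  early-disjoint i j i≢j with ℕP.<-cmp (toℕ i) (toℕ j)
  ... | tri< i<j _ _ = ordered-early-disjoint i j i<j
  ... | tri≈ _ i≡j _ = ⊥-elim (i≢j (FP.toℕ-injective i≡j))
  ... | tri> _ _ j<i = λ x in-i in-j → ordered-early-disjoint j i j<i x in-j in-i

  -- Positions 1, …, q are within distance q ≤ b of position q + 1.
  early-last-disjoint : ∀ j → j ≢ F.zero → Disjoint (game (early j)) (game last)
  early-last-disjoint F.zero 0≢0 = ⊥-elim (0≢0 refl)
  early-last-disjoint (F.suc j) _ =
    nearby (early (F.suc j)) last
      (subst₂ ℕ._<_ (sym (FP.toℕ-inject≤ (F.suc j) _)) (sym (FP.toℕ-fromℕ< _)) (FP.toℕ<n (F.suc j)))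
      (subst₂ (λ u v → v ≤ u + b) (sym (FP.toℕ-inject≤ (F.suc j) _)) (sym (FP.toℕ-fromℕ< _))
        (s≤s (ℕP.≤-trans q≤b (ℕP.m≤n+m b (toℕ j)))))

  -- Each team of the game at position q + 1 plays at position 0: the first
  -- q + 1 games involve every team, and those at positions 1, …, q do not
  -- involve it.
  last-teams-play-first : ∀ c → Involves (team c (game last)) (game (early F.zero))
  last-teams-play-first c
    with disjoint-games-cover (game ∘′ early) early-disjoint (team c (game last))
  ... | j , plays-j with j F.≟ F.zero
  ... | yes refl = plays-j
  ... | no j≢0 = ⊥-elim (early-last-disjoint j j≢0 _ plays-j (team-involved c (game last)))

  impossible : ⊥
  impossible = ℕP.0≢1+n (begin
    0                    ≡⟨ FP.toℕ-inject≤ F.zero _ ⟨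
    toℕ (early F.zero)   ≡⟨ cong toℕ (game-injective same-game) ⟩
    toℕ last             ≡⟨ FP.toℕ-fromℕ< q+1<N ⟩
    suc q                ∎)
    where
    open ≡-Reasoning
    same-game : game (early F.zero) ≡ game last
    same-game = sym (game-determined (game last) (game (early F.zero))
                       (last-teams-play-first F.zero) (last-teams-play-first (F.suc F.zero)))

proposition3p1 : (k : ℕ) → 2 ≤ k → (s : Schedule (2 * k)) →
    (b : ℕ) → RestAtLeast s b → b ≤ k ∸ 2
proposition3p1 (suc (suc m)) (s≤s (s≤s z≤n)) s b rest with b ≤? m
... | yes b≤m = b≤m
... | no b≰m = ⊥-elim (NoLongRest.impossible (suc m) (Bijection.to s) (Bijection.injective s)
                         (positions-0-to-k-exist m) b (ℕP.≰⇒> b≰m)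
                         (nearby-games-disjoint s rest))
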